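{- Let $G$ be a disconnected pseudograph with connected components $G_1, G_2, \ldots, G_k$. Then $\mathcal{K}G$ is isomorphic to $\mathcal{K}G_1 \times \mathcal{K}G_2 \times \cdots \times \mathcal{K}G_k \times \Delta_{k-1}$, where $\Delta_{k-1}$ is the $(k-1)$-simplex.
   Context: A pseudograph is a finite graph in which loops and multiple edges are allowed; it need not be connected. For a pseudograph $H$ with connected components $H_1,\dots,H_m$: a tube of $H$ is a proper connected subgraph $t$ of $H$ such that whenever two nodes of $t$ are joined by at least one edge of $H$, $t$ contains at least one edge joining them; two tubes are compatible if one properly contains the other, or if they are disjoint and cannot be connected by a single edge of $H$; a tubing of $H$ is a set of pairwise compatible tubes which does not contain all of $H_1,\ldots,H_m$. The pseudograph associahedron $\mathcal{K}H$ is the simple polytope (or polytopal cone, if $H$ has loops) whose face poset is isomorphic to the poset of tubings of $H$ ordered by reverse inclusion (a tubing with $j$ tubes corresponding to a face of codimension $j$). "Isomorphic" means having isomorphic face posets; the face poset of a product is the product of face posets. -}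

module Defs where

open import Data.Nat using (ℕ; _≤_)
open import Data.Fin using (Fin)
open import Data.Fin.Subset using (Subset; _∈_; _⊆_; Nonempty) renaming (⊤ to full)
open import Data.Product using (Σ; ∃; ∃-syntax; _×_; _,_; proj₁; proj₂)
open import Data.Sum using (_⊎_)
open import Data.Bool using (Bool; true)
open import Relation.Nullary using (¬_)
open import Relation.Binary.PropositionalEquality using (_≡_; _≢_)
open import Function.Bundles using (_↔_; Inverse)
open import Relation.Binary.Morphism.Structures using (IsOrderIsomorphism)

-- Pseudographs: finitely many nodes (Fin nV) and edges (Fin nE); each
-- edge has an unordered pair of endpoints (a loop when both coincide).
-- Multiple edges and loops are allowed.

record Pseudograph : Set where
  field
    nV   : ℕ
    nE   : ℕ
    ends : Fin nE → Fin nV × Fin nV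

open Pseudograph public

SameEnds : {n : ℕ} → Fin n × Fin n → Fin n × Fin n → Set
SameEnds (a , b) (c , d) = (a ≡ c × b ≡ d) ⊎ (a ≡ d × b ≡ c)

Joins : (G : Pseudograph) → Fin (nE G) → Fin (nV G) → Fin (nV G) → Set
Joins G e u v = SameEnds (ends G e) (u , v)

SubG : Pseudograph → Set
SubG G = Subset (nV G) × Subset (nE G)

Whole : (G : Pseudograph) → SubG G
Whole G = full , full

IsSubgraph : (G : Pseudograph) → SubG G → Set
IsSubgraph G (S , F) = ∀ e → e ∈ F → proj₁ (ends G e) ∈ S × proj₂ (ends G e) ∈ S

data Path (G : Pseudograph) (F : Subset (nE G)) : Fin (nV G) → Fin (nV G) → Set where
  here : ∀ {u} → Path G F u u
  step : ∀ {u w v} (e : Fin (nE G)) → e ∈ F → Joins G e u w → Path G F w v → Path G F u v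

ConnectedSub : (G : Pseudograph) → SubG G → Set
ConnectedSub G (S , F) =
  IsSubgraph G (S , F) × Nonempty S × (∀ u v → u ∈ S → v ∈ S → Path G F u v)

IsConnected : Pseudograph → Set
IsConnected G = ConnectedSub G (Whole G)

IsComponent : (G : Pseudograph) → SubG G → Set
IsComponent G (S , F) = ConnectedSub G (S , F) ×
  (∀ e → (proj₁ (ends G e) ∈ S ⊎ proj₂ (ends G e) ∈ S) → e ∈ F)

IsTube : (G : Pseudograph) → SubG G → Set
IsTube G (S , F) = ConnectedSub G (S , F) × ((S , F) ≢ Whole G) ×
  (∀ u v → u ∈ S → v ∈ S → u ≢ v → (∃[ e ] Joins G e u v) → ∃[ e ] (e ∈ F × Joins G e u v))

_⊃_ : {G : Pseudograph} → SubG G → SubG G → Set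
(S₁ , F₁) ⊃ (S₂ , F₂) = S₂ ⊆ S₁ × F₂ ⊆ F₁ × (S₁ , F₁) ≢ (S₂ , F₂)

FarApart : (G : Pseudograph) → SubG G → SubG G → Set
FarApart G (S₁ , F₁) (S₂ , F₂) =
  (∀ v → v ∈ S₁ → ¬ (v ∈ S₂)) ×
  (∀ e u v → u ∈ S₁ → v ∈ S₂ → ¬ Joins G e u v)

Compatible : (G : Pseudograph) → SubG G → SubG G → Set
Compatible G t₁ t₂ = (_⊃_ {G} t₁ t₂) ⊎ (_⊃_ {G} t₂ t₁) ⊎ FarApart G t₁ t₂

record Tubing (G : Pseudograph) : Set where
  field
    tubes    : SubG G → Bool
    areTubes : ∀ t → tubes t ≡ true → IsTube G t
    compat   : ∀ t t' → tubes t ≡ true → tubes t' ≡ true → t ≢ t' → Compatible G t t'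
    notAll   : ¬ (∀ C → IsComponent G C → tubes C ≡ true)

open Tubing public

-- Face poset of KG: tubings, ordered by reverse inclusion, with
-- equality = having the same tubes.

_≈T_ : {G : Pseudograph} → Tubing G → Tubing G → Set
T ≈T T' = ∀ t → tubes T t ≡ tubes T' t

_≤T_ : {G : Pseudograph} → Tubing G → Tubing G → Set
T ≤T T' = ∀ t → tubes T' t ≡ true → tubes T t ≡ true

-- (nonempty) faces of the simplex Δ_{k-1}: nonempty subsets of its k vertices,
-- ordered by inclusion
SimplexFace : ℕ → Set
SimplexFace k = Σ (Subset k) Nonempty

-- Face poset of KG₁ × ⋯ × KGₖ × Δ_{k-1} (product poset)
ProdFace : (k : ℕ) → (Fin k → Pseudograph) → Set
ProdFace k H = ((i : Fin k) → Tubing (H i)) × SimplexFace k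

_≈P_ : {k : ℕ} {H : Fin k → Pseudograph} → ProdFace k H → ProdFace k H → Set
(x , (s , _)) ≈P (y , (s' , _)) = (∀ i → x i ≈T y i) × s ≡ s'

_≤P_ : {k : ℕ} {H : Fin k → Pseudograph} → ProdFace k H → ProdFace k H → Set
(x , (s , _)) ≤P (y , (s' , _)) = (∀ i → x i ≤T y i) × s ⊆ s'

-- G has connected components H 1, …, H k: G is isomorphic (as a
-- pseudograph) to the disjoint union of the connected pseudographs H i.

record HasComponents (G : Pseudograph) (k : ℕ) (H : Fin k → Pseudograph) : Set where
  field
    connected : ∀ i → IsConnected (H i)
    vmap      : Fin (nV G) ↔ Σ (Fin k) (λ i → Fin (nV (H i)))
    emap      : Fin (nE G) ↔ Σ (Fin k) (λ i → Fin (nE (H i)))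
    endsOK    : ∀ e →
      SameEnds (ends G e)
        ( Inverse.from vmap (proj₁ (Inverse.to emap e) , proj₁ (ends (H (proj₁ (Inverse.to emap e))) (proj₂ (Inverse.to emap e))))
        , Inverse.from vmap (proj₁ (Inverse.to emap e) , proj₂ (ends (H (proj₁ (Inverse.to emap e))) (proj₂ (Inverse.to emap e)))))

FacePosetIso : (G : Pseudograph) (k : ℕ) (H : Fin k → Pseudograph) → Set
FacePosetIso G k H =
  Σ (Tubing G → ProdFace k H) λ f →
    IsOrderIsomorphism (_≈T_ {G}) (_≈P_ {k} {H}) (_≤T_ {G}) (_≤P_ {k} {H}) f

module Submission where

-- Every connected subgraph of G lies in one component, and transporting a
-- subgraph of H i into G preserves and reflects being a tube and being
-- compatible (the transported subgraph is proper because G has a second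
-- component); the components C i of G are tubes of G as well.  So a tubing T
-- of G is the same as (a) for each i, the tubes of T inside H i other than
-- H i itself, a tubing of H i, and (b) the set of components C i not in T,
-- nonempty because T does not contain every component: a face of Δ_{k-1}.

open import Defs
open import Data.Nat using (ℕ; _≤_; s≤s)
open import Data.Fin using (Fin; zero; suc) renaming (_≟_ to _≟F_)
open import Data.Fin.Properties using (any?; ¬∀⟶∃¬)
open import Data.Fin.Subset using (Subset; _∈_; _∉_; _⊆_; Nonempty) renaming (⊤ to full)
open import Data.Fin.Subset.Properties using (_∈?_; ⊆-antisym; ⊆-reflexive; ∈⊤; ⊆⊤)
open import Data.Vec using (tabulate)
open import Data.Vec.Properties using (lookup∘tabulate; []=⇒lookup; lookup⇒[]=) renaming (≡-dec to ≡-decVec)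
open import Data.Bool using (Bool; true; false) renaming (_≟_ to _≟B_)
open import Data.Empty using (⊥-elim)
open import Data.Product using (∃-syntax; _×_; _,_; proj₁; proj₂)
open import Data.Product.Properties using () renaming (≡-dec to ≡-dec×)
open import Data.Sum using (_⊎_; inj₁; inj₂)
import Data.Sum as Sum
open import Relation.Nullary using (¬_; Dec; yes; no; does)
open import Relation.Nullary.Decidable using (_×-dec_; _⊎-dec_; ¬?; map′; dec-true; decidable-stable)
open import Relation.Unary using (Decidable)
open import Relation.Binary.PropositionalEquality
open import Function.Bundles using (_↔_; Inverse)

witness : {P : Set} (P? : Dec P) → does P? ≡ true → P
witness (yes p) _ = p

bool-ext : {a b : Bool} → (a ≡ true → b ≡ true) → (b ≡ true → a ≡ true) → a ≡ b
bool-ext {false} {false} _ _ = refl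
bool-ext {false} {true}  _ b⇒a = b⇒a refl
bool-ext {true}  {false} a⇒b _ = sym (a⇒b refl)
bool-ext {true}  {true}  _ _ = refl

module _ {n : ℕ} {P : Fin n → Set} (P? : Decidable P) where

  subsetOf : Subset n
  subsetOf = tabulate (λ x → does (P? x))

  ∈-subsetOf⁺ : ∀ {x} → P x → x ∈ subsetOf
  ∈-subsetOf⁺ {x} px = lookup⇒[]= x subsetOf (trans (lookup∘tabulate _ x) (dec-true (P? x) px))

  ∈-subsetOf⁻ : ∀ {x} → x ∈ subsetOf → P x
  ∈-subsetOf⁻ {x} x∈ = witness (P? x) (trans (sym (lookup∘tabulate _ x)) ([]=⇒lookup x∈))

module Blocks {N k : ℕ} {n : Fin k → ℕ} (split : Fin N ↔ (∃[ i ] Fin (n i))) where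
  open Inverse split using (to; from; strictlyInverseˡ; strictlyInverseʳ)

  ι : (i : Fin k) → Fin (n i) → Fin N
  ι i w = from (i , w)

  block : Fin N → Fin k
  block x = proj₁ (to x)

  block-ι : ∀ i w → block (ι i w) ≡ i
  block-ι i w = cong proj₁ (strictlyInverseˡ (i , w))

  ι-injective : ∀ i {w w'} → ι i w ≡ ι i w' → w ≡ w'
  ι-injective i {w} {w'} eq = second (trans (sym (strictlyInverseˡ (i , w)))
                                       (trans (cong to eq) (strictlyInverseˡ (i , w'))))
    where
    second : ∀ {a b} → _≡_ {A = ∃[ j ] Fin (n j)} (i , a) (i , b) → a ≡ b
    second refl = refl

  data View : Fin N → Set where
    at : ∀ i w → View (ι i w)

  view : ∀ x → View x
  view x = subst View (strictlyInverseʳ x) (at (proj₁ (to x)) (proj₂ (to x)))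

  ι-onto : ∀ x {i} → block x ≡ i → ∃[ w ] x ≡ ι i w
  ι-onto x refl = proj₂ (to x) , sym (strictlyInverseʳ x)

  inPush? : ∀ i S x → Dec (∃[ w ] x ≡ ι i w × w ∈ S)
  inPush? i S x = any? (λ w → (x ≟F ι i w) ×-dec (w ∈? S))

  push : (i : Fin k) → Subset (n i) → Subset N
  push i S = subsetOf (inPush? i S)

  ∈-push⁺ : ∀ {i S w} → w ∈ S → ι i w ∈ push i S
  ∈-push⁺ {i} {S} {w} w∈ = ∈-subsetOf⁺ (inPush? i S) (w , refl , w∈)

  ∈-push⁻ : ∀ {i S x} → x ∈ push i S → ∃[ w ] x ≡ ι i w × w ∈ S
  ∈-push⁻ {i} {S} = ∈-subsetOf⁻ (inPush? i S)

  ι∈push⁻ : ∀ {i S w} → ι i w ∈ push i S → w ∈ S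
  ι∈push⁻ {i} x∈ with ∈-push⁻ x∈
  ... | w , eq , w∈ rewrite ι-injective i eq = w∈

  block-push : ∀ {i S x} → x ∈ push i S → block x ≡ i
  block-push x∈ with ∈-push⁻ x∈
  ... | w , refl , _ = block-ι _ w

  push-mono : ∀ i {S S'} → S ⊆ S' → push i S ⊆ push i S'
  push-mono i S⊆S' x∈ with ∈-push⁻ x∈
  ... | w , refl , w∈ = ∈-push⁺ (S⊆S' w∈)

  push-reflects-⊆ : ∀ i {S S'} → push i S ⊆ push i S' → S ⊆ S'
  push-reflects-⊆ i sub w∈ = ι∈push⁻ (sub (∈-push⁺ w∈))

  push-injective : ∀ i {S S'} → push i S ≡ push i S' → S ≡ S'
  push-injective i eq = ⊆-antisym (push-reflects-⊆ i (λ x∈ → subst (_ ∈_) eq x∈))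
                                  (push-reflects-⊆ i (λ x∈ → subst (_ ∈_) (sym eq) x∈))

  pull : (i : Fin k) → Subset N → Subset (n i)
  pull i S' = subsetOf (λ w → ι i w ∈? S')

  ∈-pull⁺ : ∀ {i S' w} → ι i w ∈ S' → w ∈ pull i S'
  ∈-pull⁺ {i} {S'} = ∈-subsetOf⁺ (λ w → ι i w ∈? S')

  ∈-pull⁻ : ∀ {i S' w} → w ∈ pull i S' → ι i w ∈ S'
  ∈-pull⁻ {i} {S'} = ∈-subsetOf⁻ (λ w → ι i w ∈? S')

  pull-push : ∀ i S → pull i (push i S) ≡ S
  pull-push i S = ⊆-antisym (λ w∈ → ι∈push⁻ (∈-pull⁻ w∈)) (λ w∈ → ∈-pull⁺ (∈-push⁺ w∈))

  push-pull : ∀ i S' → (∀ {x} → x ∈ S' → block x ≡ i) → push i (pull i S') ≡ S'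
  push-pull i S' inside = ⊆-antisym ⊆S' S'⊆
    where
    ⊆S' : push i (pull i S') ⊆ S'
    ⊆S' x∈ with ∈-push⁻ x∈
    ... | w , refl , w∈ = ∈-pull⁻ w∈
    S'⊆ : S' ⊆ push i (pull i S')
    S'⊆ {x} x∈ with ι-onto x (inside x∈)
    ... | w , refl = ∈-push⁺ (∈-pull⁺ x∈)

  push-block-unique : ∀ {i j S S'} → Nonempty S → push i S ⊆ push j S' → i ≡ j
  push-block-unique {i} (w , w∈) sub = trans (sym (block-ι i w)) (block-push (sub (∈-push⁺ w∈)))

module _ {n : ℕ} where

  SE-sym : {p q : Fin n × Fin n} → SameEnds p q → SameEnds q p
  SE-sym (inj₁ (refl , refl)) = inj₁ (refl , refl)
  SE-sym (inj₂ (refl , refl)) = inj₂ (refl , refl)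

  SE-trans : {p q r : Fin n × Fin n} → SameEnds p q → SameEnds q r → SameEnds p r
  SE-trans (inj₁ (refl , refl)) q≈r = q≈r
  SE-trans (inj₂ (refl , refl)) (inj₁ (refl , refl)) = inj₂ (refl , refl)
  SE-trans (inj₂ (refl , refl)) (inj₂ (refl , refl)) = inj₁ (refl , refl)

  SE-both : (P : Fin n → Set) {a b c d : Fin n} → SameEnds (a , b) (c , d) → P a → P b → P c × P d
  SE-both P (inj₁ (refl , refl)) pa pb = pa , pb
  SE-both P (inj₂ (refl , refl)) pa pb = pb , pa

  SE-either : (P : Fin n → Set) {a b c d : Fin n} → SameEnds (a , b) (c , d) → P c ⊎ P d → P a ⊎ P b
  SE-either P (inj₁ (refl , refl)) pcd = pcd
  SE-either P (inj₂ (refl , refl)) (inj₁ pc) = inj₂ pc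
  SE-either P (inj₂ (refl , refl)) (inj₂ pd) = inj₁ pd

module _ {n m : ℕ} (f : Fin n → Fin m) where

  SE-map : {a b c d : Fin n} → SameEnds (a , b) (c , d) → SameEnds (f a , f b) (f c , f d)
  SE-map (inj₁ (refl , refl)) = inj₁ (refl , refl)
  SE-map (inj₂ (refl , refl)) = inj₂ (refl , refl)

  SE-unmap : (∀ {x y} → f x ≡ f y → x ≡ y) →
             {a b c d : Fin n} → SameEnds (f a , f b) (f c , f d) → SameEnds (a , b) (c , d)
  SE-unmap inj (inj₁ (p , q)) = inj₁ (inj p , inj q)
  SE-unmap inj (inj₂ (p , q)) = inj₂ (inj p , inj q)

Saturated : (X : Pseudograph) → SubG X → Set
Saturated X (S , F) =
  ∀ u v → u ∈ S → v ∈ S → u ≢ v → (∃[ e ] Joins X e u v) → ∃[ e ] (e ∈ F × Joins X e u v)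

EdgeClosed : (X : Pseudograph) → SubG X → Set
EdgeClosed X (S , F) = ∀ e → (proj₁ (ends X e) ∈ S ⊎ proj₂ (ends X e) ∈ S) → e ∈ F

-- In a connected pseudograph, a nonempty edge-closed subgraph is everything:
-- walking along any path from one of its nodes never leaves it.
edgeClosed-whole : (X : Pseudograph) → IsConnected X →
  ∀ S F → IsSubgraph X (S , F) → Nonempty S → EdgeClosed X (S , F) → (S , F) ≡ Whole X
edgeClosed-whole X (_ , _ , paths) S F sub (a , a∈) closed =
  cong₂ _,_ (⊆-antisym ⊆⊤ λ {v} _ → walk (paths a v ∈⊤ ∈⊤) a∈)
            (⊆-antisym ⊆⊤ λ {e} _ → closed e (inj₁ (walk (paths a _ ∈⊤ ∈⊤) a∈)))
  where
  walk : ∀ {u v} → Path X full u v → u ∈ S → v ∈ S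
  walk here u∈ = u∈
  walk (step e _ j rest) u∈ =
    walk rest (proj₂ (SE-both (_∈ S) j (proj₁ ends∈) (proj₂ ends∈)))
    where
    ends∈ : proj₁ (ends X e) ∈ S × proj₂ (ends X e) ∈ S
    ends∈ = sub e (closed e (SE-either (_∈ S) j (inj₁ u∈)))

module Components (G : Pseudograph) {k : ℕ} {H : Fin k → Pseudograph}
                  (hc : HasComponents G k H) where
  open HasComponents hc
  module V = Blocks vmap
  module E = Blocks emap

  ends-ι : ∀ i e' → SameEnds (ends G (E.ι i e')) (V.ι i (proj₁ (ends (H i) e')) , V.ι i (proj₂ (ends (H i) e')))
  ends-ι i e' = subst EndsIn (Inverse.strictlyInverseˡ emap (i , e')) (endsOK (E.ι i e'))
    where
    EndsIn : ∃[ j ] Fin (nE (H j)) → Set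
    EndsIn (j , f) = SameEnds (ends G (E.ι i e')) (V.ι j (proj₁ (ends (H j) f)) , V.ι j (proj₂ (ends (H j) f)))

  joins↑ : ∀ {i e' a b} → Joins (H i) e' a b → Joins G (E.ι i e') (V.ι i a) (V.ι i b)
  joins↑ {i} {e'} j = SE-trans (ends-ι i e') (SE-map (V.ι i) j)

  joins↓ : ∀ {i e' a b} → Joins G (E.ι i e') (V.ι i a) (V.ι i b) → Joins (H i) e' a b
  joins↓ {i} {e'} j = SE-unmap (V.ι i) (V.ι-injective i) (SE-trans (SE-sym (ends-ι i e')) j)

  joins-block : ∀ {e u v} → Joins G e u v → V.block u ≡ E.block e × V.block v ≡ E.block e
  joins-block {e} j with E.view e
  ... | E.at i e' with SE-both (λ x → V.block x ≡ i) (SE-trans (SE-sym (ends-ι i e')) j)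
                               (V.block-ι i _) (V.block-ι i _)
  ...   | u∈i , v∈i = trans u∈i (sym (E.block-ι i e')) , trans v∈i (sym (E.block-ι i e'))

  edge-at : ∀ {i e a y} → Joins G e (V.ι i a) y → ∃[ e' ] e ≡ E.ι i e'
  edge-at {i} {e} {a} j = E.ι-onto e (trans (sym (proj₁ (joins-block j))) (V.block-ι i a))

  path-block : ∀ {F u v} → Path G F u v → V.block u ≡ V.block v
  path-block here = refl
  path-block (step e _ j rest) =
    trans (proj₁ (joins-block j)) (trans (sym (proj₂ (joins-block j))) (path-block rest))

  pushG : (i : Fin k) → SubG (H i) → SubG G
  pushG i (S , F) = V.push i S , E.push i F

  pullG : (i : Fin k) → SubG G → SubG (H i)
  pullG i (S , F) = V.pull i S , E.pull i F

  pullG-pushG : ∀ i t → pullG i (pushG i t) ≡ t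
  pullG-pushG i (S , F) = cong₂ _,_ (V.pull-push i S) (E.pull-push i F)

  pushG-injective : ∀ i {t t'} → pushG i t ≡ pushG i t' → t ≡ t'
  pushG-injective i {S , F} eq = cong₂ _,_ (V.push-injective i (cong proj₁ eq)) (E.push-injective i (cong proj₂ eq))

  pushG-block-unique : ∀ {i j t t'} → Nonempty (proj₁ t) → pushG i t ≡ pushG j t' → i ≡ j
  pushG-block-unique {t = S , F} ne eq = V.push-block-unique ne (⊆-reflexive (cong proj₁ eq))

  sub↑ : ∀ i t → IsSubgraph (H i) t → IsSubgraph G (pushG i t)
  sub↑ i (S , F) sub e e∈ with E.∈-push⁻ e∈
  ... | e' , refl , e'∈ = SE-both (_∈ V.push i S) (SE-sym (ends-ι i e'))
                                  (V.∈-push⁺ (proj₁ (sub e' e'∈))) (V.∈-push⁺ (proj₂ (sub e' e'∈)))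

  sub↓ : ∀ i t → IsSubgraph G (pushG i t) → IsSubgraph (H i) t
  sub↓ i (S , F) sub e' e'∈ =
    V.ι∈push⁻ (proj₁ images) , V.ι∈push⁻ (proj₂ images)
    where
    ends∈ : proj₁ (ends G (E.ι i e')) ∈ V.push i S × proj₂ (ends G (E.ι i e')) ∈ V.push i S
    ends∈ = sub (E.ι i e') (E.∈-push⁺ e'∈)
    images : V.ι i (proj₁ (ends (H i) e')) ∈ V.push i S × V.ι i (proj₂ (ends (H i) e')) ∈ V.push i S
    images = SE-both (_∈ V.push i S) (ends-ι i e') (proj₁ ends∈) (proj₂ ends∈)

  path↑ : ∀ {i F a b} → Path (H i) F a b → Path G (E.push i F) (V.ι i a) (V.ι i b)
  path↑ here = here
  path↑ {i} (step e' e'∈ j rest) = step (E.ι i e') (E.∈-push⁺ e'∈) (joins↑ j) (path↑ rest)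

  path↓ : ∀ {i F x y a b} → Path G (E.push i F) x y → x ≡ V.ι i a → y ≡ V.ι i b → Path (H i) F a b
  path↓ {i} here refl eq rewrite V.ι-injective i eq = here
  path↓ {i} (step e e∈ j rest) refl eq with E.∈-push⁻ e∈
  ... | e' , refl , e'∈ with V.ι-onto _ (trans (proj₂ (joins-block j)) (E.block-ι i e'))
  ...   | b' , refl = step e' e'∈ (joins↓ j) (path↓ rest refl eq)

  conn↑ : ∀ i t → ConnectedSub (H i) t → ConnectedSub G (pushG i t)
  conn↑ i (S , F) (sub , (a , a∈) , paths) = sub↑ i (S , F) sub , (V.ι i a , V.∈-push⁺ a∈) , paths↑
    where
    paths↑ : ∀ u v → u ∈ V.push i S → v ∈ V.push i S → Path G (E.push i F) u v
    paths↑ u v u∈ v∈ with V.∈-push⁻ u∈ | V.∈-push⁻ v∈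
    ... | a , refl , a∈ | b , refl , b∈ = path↑ (paths a b a∈ b∈)

  conn↓ : ∀ i t → ConnectedSub G (pushG i t) → ConnectedSub (H i) t
  conn↓ i (S , F) (sub , (x , x∈) , paths) = sub↓ i (S , F) sub , nonempty , paths↓
    where
    nonempty : Nonempty S
    nonempty with V.∈-push⁻ x∈
    ... | a , _ , a∈ = a , a∈
    paths↓ : ∀ a b → a ∈ S → b ∈ S → Path (H i) F a b
    paths↓ a b a∈ b∈ = path↓ (paths _ _ (V.∈-push⁺ a∈) (V.∈-push⁺ b∈)) refl refl

  sat↑ : ∀ i t → Saturated (H i) t → Saturated G (pushG i t)
  sat↑ i (S , F) sat u v u∈ v∈ u≢v (e , j) with V.∈-push⁻ u∈ | V.∈-push⁻ v∈
  ... | a , refl , a∈ | b , refl , b∈ with edge-at j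
  ...   | e' , refl with sat a b a∈ b∈ (λ a≡b → u≢v (cong (V.ι i) a≡b)) (e' , joins↓ j)
  ...     | f , f∈ , jf = E.ι i f , E.∈-push⁺ f∈ , joins↑ jf

  sat↓ : ∀ i t → Saturated G (pushG i t) → Saturated (H i) t
  sat↓ i (S , F) sat a b a∈ b∈ a≢b (e' , j)
    with sat (V.ι i a) (V.ι i b) (V.∈-push⁺ a∈) (V.∈-push⁺ b∈)
             (λ eq → a≢b (V.ι-injective i eq)) (E.ι i e' , joins↑ j)
  ... | e , e∈ , je with E.∈-push⁻ e∈
  ...   | f , refl , f∈ = f , f∈ , joins↓ je

  far↑ : ∀ i t t' → FarApart (H i) t t' → FarApart G (pushG i t) (pushG i t')
  far↑ i (S , F) (S' , F') (disjoint , unjoined) = disjoint↑ , unjoined↑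
    where
    disjoint↑ : ∀ v → v ∈ V.push i S → v ∉ V.push i S'
    disjoint↑ v v∈ v∈' with V.∈-push⁻ v∈
    ... | a , refl , a∈ = disjoint a a∈ (V.ι∈push⁻ v∈')
    unjoined↑ : ∀ e u v → u ∈ V.push i S → v ∈ V.push i S' → ¬ Joins G e u v
    unjoined↑ e u v u∈ v∈ j with V.∈-push⁻ u∈ | V.∈-push⁻ v∈
    ... | a , refl , a∈ | b , refl , b∈ with edge-at j
    ...   | e' , refl = unjoined e' a b a∈ b∈ (joins↓ j)

  far↓ : ∀ i t t' → FarApart G (pushG i t) (pushG i t') → FarApart (H i) t t'
  far↓ i (S , F) (S' , F') (disjoint , unjoined) =
    (λ v v∈ v∈' → disjoint (V.ι i v) (V.∈-push⁺ v∈) (V.∈-push⁺ v∈')) ,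
    (λ e u v u∈ v∈ j → unjoined (E.ι i e) (V.ι i u) (V.ι i v) (V.∈-push⁺ u∈) (V.∈-push⁺ v∈) (joins↑ j))

  far-blocks : ∀ {i j} t t' → i ≢ j → FarApart G (pushG i t) (pushG j t')
  far-blocks (S , F) (S' , F') i≢j =
    (λ v v∈ v∈' → i≢j (trans (sym (V.block-push v∈)) (V.block-push v∈'))) ,
    (λ e u v u∈ v∈ j → i≢j (trans (sym (V.block-push u∈))
                             (trans (proj₁ (joins-block j)) (trans (sym (proj₂ (joins-block j))) (V.block-push v∈)))))

  ⊃↑ : ∀ i {t t'} → _⊃_ {H i} t t' → _⊃_ {G} (pushG i t) (pushG i t')
  ⊃↑ i {S , F} {S' , F'} (S'⊆S , F'⊆F , t≢t') =
    V.push-mono i S'⊆S , E.push-mono i F'⊆F , λ eq → t≢t' (pushG-injective i eq)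

  ⊃↓ : ∀ i {t t'} → _⊃_ {G} (pushG i t) (pushG i t') → _⊃_ {H i} t t'
  ⊃↓ i {S , F} {S' , F'} (S'⊆S , F'⊆F , t≢t') =
    V.push-reflects-⊆ i S'⊆S , E.push-reflects-⊆ i F'⊆F , λ eq → t≢t' (cong (pushG i) eq)

  compat↑ : ∀ i t t' → Compatible (H i) t t' → Compatible G (pushG i t) (pushG i t')
  compat↑ i t t' (inj₁ t⊃t') = inj₁ (⊃↑ i t⊃t')
  compat↑ i t t' (inj₂ (inj₁ t'⊃t)) = inj₂ (inj₁ (⊃↑ i t'⊃t))
  compat↑ i t t' (inj₂ (inj₂ far)) = inj₂ (inj₂ (far↑ i t t' far))

  compat↓ : ∀ i t t' → Compatible G (pushG i t) (pushG i t') → Compatible (H i) t t'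
  compat↓ i t t' (inj₁ t⊃t') = inj₁ (⊃↓ i t⊃t')
  compat↓ i t t' (inj₂ (inj₁ t'⊃t)) = inj₂ (inj₁ (⊃↓ i t'⊃t))
  compat↓ i t t' (inj₂ (inj₂ far)) = inj₂ (inj₂ (far↓ i t t' far))

  connected-in-block : ∀ t → ConnectedSub G t → ∃[ i ] t ≡ pushG i (pullG i t)
  connected-in-block (S , F) (sub , (a , a∈) , paths) =
    V.block a , sym (cong₂ _,_ (V.push-pull _ S nodes) (E.push-pull _ F edges))
    where
    nodes : ∀ {x} → x ∈ S → V.block x ≡ V.block a
    nodes x∈ = sym (path-block (paths a _ a∈ x∈))
    edges : ∀ {e} → e ∈ F → E.block e ≡ V.block a
    edges {e} e∈ = trans (sym (proj₁ (joins-block {e} (inj₁ (refl , refl))))) (nodes (proj₁ (sub e e∈)))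

  C : Fin k → SubG G
  C i = pushG i (Whole (H i))

  C-component : ∀ i → IsComponent G (C i)
  C-component i = conn↑ i (Whole (H i)) (connected i) , closed
    where
    edge∈ : ∀ {e x} → x ∈ V.push i full → V.block x ≡ E.block e → e ∈ E.push i full
    edge∈ {e} x∈ eq with E.ι-onto e (trans (sym eq) (V.block-push x∈))
    ... | e' , refl = E.∈-push⁺ ∈⊤
    closed : EdgeClosed G (C i)
    closed e (inj₁ x∈) = edge∈ x∈ (proj₁ (joins-block {e} (inj₁ (refl , refl))))
    closed e (inj₂ x∈) = edge∈ x∈ (proj₂ (joins-block {e} (inj₁ (refl , refl))))

  edgeClosed↓ : ∀ i t → EdgeClosed G (pushG i t) → EdgeClosed (H i) t
  edgeClosed↓ i (S , F) closed e' touches =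
    E.ι∈push⁻ (closed (E.ι i e') (SE-either (_∈ V.push i S) (ends-ι i e') (Sum.map V.∈-push⁺ V.∈-push⁺ touches)))

  component-is-C : ∀ D → IsComponent G D → ∃[ i ] D ≡ C i
  component-is-C D (conn , closed) with connected-in-block D conn
  ... | i , D≡push = i , trans D≡push (cong (pushG i) pull≡whole)
    where
    u : SubG (H i)
    u = pullG i D
    connH : ConnectedSub (H i) u
    connH = conn↓ i u (subst (ConnectedSub G) D≡push conn)
    pull≡whole : u ≡ Whole (H i)
    pull≡whole = edgeClosed-whole (H i) (connected i) (proj₁ u) (proj₂ u)
                   (proj₁ connH) (proj₁ (proj₂ connH))
                   (edgeClosed↓ i u (subst (EdgeClosed G) D≡push closed))

_≟G_ : {X : Pseudograph} → (t t' : SubG X) → Dec (t ≡ t')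
_≟G_ = ≡-dec× (≡-decVec _≟B_) (≡-decVec _≟B_)

≈T⇒≤T : ∀ {X} {T T' : Tubing X} → _≈T_ {X} T T' → _≤T_ {X} T T'
≈T⇒≤T T≈T' t p = trans (T≈T' t) p

≈T⇒≥T : ∀ {X} {T T' : Tubing X} → _≈T_ {X} T T' → _≤T_ {X} T' T
≈T⇒≥T T≈T' t p = trans (sym (T≈T' t)) p

module _ {k : ℕ} {H : Fin k → Pseudograph} where

  ≈P⇒≤P : ∀ {a b} → _≈P_ {k} {H} a b → _≤P_ {k} {H} a b
  ≈P⇒≤P (a≈b , s≡s') = (λ i u p → trans (a≈b i u) p) , λ i∈ → subst (_ ∈_) s≡s' i∈

  ≈P⇒≥P : ∀ {a b} → _≈P_ {k} {H} a b → _≤P_ {k} {H} b a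
  ≈P⇒≥P (a≈b , s≡s') = (λ i u p → trans (sym (a≈b i u)) p) , λ i∈ → subst (_ ∈_) (sym s≡s') i∈

  ≈P-trans : ∀ {a b c} → _≈P_ {k} {H} a b → _≈P_ {k} {H} b c → _≈P_ {k} {H} a c
  ≈P-trans (a≈b , s≡s') (b≈c , s'≡s'') = (λ i u → trans (a≈b i u) (b≈c i u)) , trans s≡s' s'≡s''

other-index : {k : ℕ} → 2 ≤ k → (i : Fin k) → ∃[ j ] j ≢ i
other-index (s≤s (s≤s _)) zero = suc zero , λ ()
other-index (s≤s (s≤s _)) (suc i) = zero , λ ()

module FaceIso (G : Pseudograph) (k : ℕ) (H : Fin k → Pseudograph)
               (two : 2 ≤ k) (hc : HasComponents G k H) where
  open HasComponents hc using (connected)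
  open Components G hc

  -- since G has another (nonempty) component, no subgraph of one component is all of G
  pushG-proper : ∀ i t → pushG i t ≢ Whole G
  pushG-proper i (S , F) eq with other-index two i
  ... | j , j≢i with connected j
  ...   | _ , (a , _) , _ =
    j≢i (trans (sym (V.block-ι j a)) (V.block-push (subst (V.ι j a ∈_) (sym (cong proj₁ eq)) ∈⊤)))

  tube↑ : ∀ i t → IsTube (H i) t → IsTube G (pushG i t)
  tube↑ i t (conn , _ , sat) = conn↑ i t conn , pushG-proper i t , sat↑ i t sat

  tube↓ : ∀ i t → IsTube G (pushG i t) → t ≢ Whole (H i) → IsTube (H i) t
  tube↓ i t (conn , _ , sat) t≢W = conn↓ i t conn , t≢W , sat↓ i t sat

  C-tube : ∀ i → IsTube G (C i)
  C-tube i = conn↑ i (Whole (H i)) (connected i) , pushG-proper i _ ,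
             sat↑ i (Whole (H i)) (λ _ _ _ _ _ (e , j) → e , ∈⊤ , j)

  C⊃ : ∀ i t → t ≢ Whole (H i) → _⊃_ {G} (C i) (pushG i t)
  C⊃ i (S , F) t≢W = ⊃↑ i {Whole (H i)} {S , F} (⊆⊤ , ⊆⊤ , λ eq → t≢W (sym eq))

  H-nonempty : ∀ i → Nonempty (proj₁ (Whole (H i)))
  H-nonempty i = proj₁ (proj₂ (connected i))

  InRestriction : Tubing G → (i : Fin k) → SubG (H i) → Set
  InRestriction T i u = u ≢ Whole (H i) × tubes T (pushG i u) ≡ true

  inRestriction? : ∀ T i u → Dec (InRestriction T i u)
  inRestriction? T i u = ¬? (_≟G_ {H i} u (Whole (H i))) ×-dec (tubes T (pushG i u) ≟B true)

  restrict : Tubing G → (i : Fin k) → Tubing (H i)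
  restrict T i = record
    { tubes    = λ u → does (inRestriction? T i u)
    ; areTubes = λ u p → let (u≢W , u∈T) = witness (inRestriction? T i u) p
                         in tube↓ i u (areTubes T _ u∈T) u≢W
    ; compat   = λ u u' p p' u≢u' →
        compat↓ i u u' (compat T _ _ (proj₂ (witness (inRestriction? T i u) p))
                                     (proj₂ (witness (inRestriction? T i u') p'))
                                     (λ eq → u≢u' (pushG-injective i eq)))
    ; notAll   = λ all → proj₁ (witness (inRestriction? T i (Whole (H i)))
                                 (all (Whole (H i)) (connected i , λ e _ → ∈⊤ {x = e}))) refl
    }

  C∉? : (T : Tubing G) → ∀ i → Dec (tubes T (C i) ≢ true)
  C∉? T i = ¬? (tubes T (C i) ≟B true)

  free : Tubing G → Subset k
  free T = subsetOf (C∉? T)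

  free-nonempty : ∀ T → Nonempty (free T)
  free-nonempty T =
    let (i , C∉T) = ¬∀⟶∃¬ k (λ i → tubes T (C i) ≡ true) (λ i → tubes T (C i) ≟B true) allC∈T-impossible
    in i , ∈-subsetOf⁺ (C∉? T) C∉T
    where
    -- if every C i were in T, every component would be, as the C i are all of them
    allC∈T-impossible : ¬ (∀ i → tubes T (C i) ≡ true)
    allC∈T-impossible allC = notAll T λ D D-comp →
      subst (λ t → tubes T t ≡ true) (sym (proj₂ (component-is-C D D-comp))) (allC _)

  fwd : Tubing G → ProdFace k H
  fwd T = restrict T , free T , free-nonempty T

  module Glue (y : ProdFace k H) where
    x : (i : Fin k) → Tubing (H i)
    x = proj₁ y

    s : Subset k
    s = proj₁ (proj₂ y)

    data Glued (t : SubG G) : Set where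
      component : ∀ i → i ∉ s → t ≡ C i → Glued t
      lifted    : ∀ i w → tubes (x i) w ≡ true → t ≡ pushG i w → Glued t

    glued? : ∀ t → Dec (Glued t)
    glued? t = map′ fromSum toSum
      (any? (λ i → ¬? (i ∈? s) ×-dec _≟G_ {G} t (C i)) ⊎-dec
       any? (λ i → (tubes (x i) (pullG i t) ≟B true) ×-dec _≟G_ {G} t (pushG i (pullG i t))))
      where
      fromSum : (∃[ i ] i ∉ s × t ≡ C i) ⊎ (∃[ i ] tubes (x i) (pullG i t) ≡ true × t ≡ pushG i (pullG i t)) → Glued t
      fromSum (inj₁ (i , i∉s , t≡C)) = component i i∉s t≡C
      fromSum (inj₂ (i , w∈x , t≡push)) = lifted i (pullG i t) w∈x t≡push
      toSum : Glued t → (∃[ i ] i ∉ s × t ≡ C i) ⊎ (∃[ i ] tubes (x i) (pullG i t) ≡ true × t ≡ pushG i (pullG i t))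
      toSum (component i i∉s t≡C) = inj₁ (i , i∉s , t≡C)
      toSum (lifted i w w∈x refl) = inj₂ (i , subst (λ v → tubes (x i) v ≡ true) (sym (pullG-pushG i w)) w∈x ,
                                               cong (pushG i) (sym (pullG-pushG i w)))

    tube-proper : ∀ i w → tubes (x i) w ≡ true → w ≢ Whole (H i)
    tube-proper i w w∈x = proj₁ (proj₂ (areTubes (x i) w w∈x))

    glued-C : ∀ i → Glued (C i) → i ∉ s
    glued-C i (component j j∉s C≡C) with pushG-block-unique (H-nonempty i) C≡C
    ... | refl = j∉s
    glued-C i (lifted j w w∈x C≡push) with pushG-block-unique (H-nonempty i) C≡push
    ... | refl = ⊥-elim (tube-proper i w w∈x (sym (pushG-injective i C≡push)))

    -- the glued subgraphs are tubes of G and pairwise compatible: within one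
    -- component by transport, across components by far-apartness
    glued-tube : ∀ t → Glued t → IsTube G t
    glued-tube t (component i _ refl) = C-tube i
    glued-tube t (lifted i w w∈x refl) = tube↑ i w (areTubes (x i) w w∈x)

    glued-compat : ∀ t t' → Glued t → Glued t' → t ≢ t' → Compatible G t t'
    glued-compat t t' (component i _ refl) (component j _ refl) t≢t' with i ≟F j
    ... | yes refl = ⊥-elim (t≢t' refl)
    ... | no i≢j = inj₂ (inj₂ (far-blocks (Whole (H i)) (Whole (H j)) i≢j))
    glued-compat t t' (component i _ refl) (lifted j w w∈x refl) _ with i ≟F j
    ... | yes refl = inj₁ (C⊃ i w (tube-proper i w w∈x))
    ... | no i≢j = inj₂ (inj₂ (far-blocks (Whole (H i)) w i≢j))
    glued-compat t t' (lifted i w w∈x refl) (component j _ refl) _ with i ≟F j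
    ... | yes refl = inj₂ (inj₁ (C⊃ i w (tube-proper i w w∈x)))
    ... | no i≢j = inj₂ (inj₂ (far-blocks w (Whole (H j)) i≢j))
    glued-compat t t' (lifted i w w∈x refl) (lifted j w' w'∈x refl) t≢t' with i ≟F j
    ... | yes refl = compat↑ i w w' (compat (x i) w w' w∈x w'∈x (λ w≡w' → t≢t' (cong (pushG i) w≡w')))
    ... | no i≢j = inj₂ (inj₂ (far-blocks w w' i≢j))

    -- it is a tubing since C i for a chosen i ∈ s is left out
    glue : Tubing G
    glue = record
      { tubes    = λ t → does (glued? t)
      ; areTubes = λ t p → glued-tube t (witness (glued? t) p)
      ; compat   = λ t t' p p' → glued-compat t t' (witness (glued? t) p) (witness (glued? t') p')
      ; notAll   = λ all → let (i , i∈s) = proj₂ (proj₂ y)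
                           in glued-C i (witness (glued? (C i)) (all (C i) (C-component i))) i∈s
      }

    lifted-back : ∀ i u → u ≢ Whole (H i) → Glued (pushG i u) → tubes (x i) u ≡ true
    lifted-back i u u≢W (component j _ push≡C) with pushG-block-unique (H-nonempty j) (sym push≡C)
    ... | refl = ⊥-elim (u≢W (pushG-injective i push≡C))
    lifted-back i u u≢W (lifted j w w∈x push≡push)
      with pushG-block-unique (proj₁ (proj₂ (proj₁ (areTubes (x j) w w∈x)))) (sym push≡push)
    ... | refl = subst (λ v → tubes (x i) v ≡ true) (sym (pushG-injective i push≡push)) w∈x

    restrict-glue : ∀ i u → tubes (restrict glue i) u ≡ tubes (x i) u
    restrict-glue i u = bool-ext
      (λ p → let (u≢W , u∈glue) = witness (inRestriction? glue i u) p
             in lifted-back i u u≢W (witness (glued? (pushG i u)) u∈glue))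
      (λ u∈x → dec-true (inRestriction? glue i u)
                 (tube-proper i u u∈x , dec-true (glued? (pushG i u)) (lifted i u u∈x refl)))

    free-glue : free glue ≡ s
    free-glue = ⊆-antisym
      (λ {i} i∈free → decidable-stable (i ∈? s) λ i∉s →
         ∈-subsetOf⁻ (C∉? glue) i∈free (dec-true (glued? (C i)) (component i i∉s refl)))
      (λ {i} i∈s → ∈-subsetOf⁺ (C∉? glue) λ C∈glue → glued-C i (witness (glued? (C i)) C∈glue) i∈s)

    fwd-glue : _≈P_ {k} {H} (fwd glue) y
    fwd-glue = restrict-glue , free-glue

  restrict-mono : ∀ {T T'} → _≤T_ {G} T T' → ∀ i → _≤T_ {H i} (restrict T i) (restrict T' i)
  restrict-mono {T} {T'} T≤T' i u p =
    let (u≢W , u∈T') = witness (inRestriction? T' i u) p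
    in dec-true (inRestriction? T i u) (u≢W , T≤T' _ u∈T')

  free-mono : ∀ {T T'} → _≤T_ {G} T T' → free T ⊆ free T'
  free-mono {T} {T'} T≤T' i∈free =
    ∈-subsetOf⁺ (C∉? T') λ C∈T' → ∈-subsetOf⁻ (C∉? T) i∈free (T≤T' _ C∈T')

  fwd-mono : ∀ {T T'} → _≤T_ {G} T T' → _≤P_ {k} {H} (fwd T) (fwd T')
  fwd-mono {T} {T'} T≤T' = restrict-mono {T} {T'} T≤T' , free-mono {T} {T'} T≤T'

  fwd-cong : ∀ {T T'} → _≈T_ {G} T T' → _≈P_ {k} {H} (fwd T) (fwd T')
  fwd-cong {T} {T'} T≈T' =
    (λ i u → bool-ext (restrict-mono {T'} {T} T'≤T i u) (restrict-mono {T} {T'} T≤T' i u)) ,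
    ⊆-antisym (free-mono {T} {T'} T≤T') (free-mono {T'} {T} T'≤T)
    where
    T≤T' : _≤T_ {G} T T'
    T≤T' = ≈T⇒≤T {G} {T} {T'} T≈T'
    T'≤T : _≤T_ {G} T' T
    T'≤T = ≈T⇒≥T {G} {T} {T'} T≈T'

  -- fwd reflects the order: a tube of T' inside H i is either a tube of
  -- the restriction of T' or the component C i itself, which is not free
  cancel-pushed : ∀ {T T'} → _≤P_ {k} {H} (fwd T) (fwd T') →
    ∀ i u → tubes T' (pushG i u) ≡ true → tubes T (pushG i u) ≡ true
  cancel-pushed {T} {T'} (restrict≤ , free⊆) i u u∈T' with _≟G_ {H i} u (Whole (H i))
  ... | yes refl = decidable-stable (tubes T (C i) ≟B true) λ C∉T →
                     ∈-subsetOf⁻ (C∉? T') (free⊆ (∈-subsetOf⁺ (C∉? T) C∉T)) u∈T'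
  ... | no u≢W = proj₂ (witness (inRestriction? T i u)
                          (restrict≤ i u (dec-true (inRestriction? T' i u) (u≢W , u∈T'))))

  -- every tube of T' lies in some component, so cancel-pushed covers it
  fwd-cancel : ∀ {T T'} → _≤P_ {k} {H} (fwd T) (fwd T') → _≤T_ {G} T T'
  fwd-cancel {T} {T'} le t t∈T' =
    let (i , t≡push) = connected-in-block t (proj₁ (areTubes T' t t∈T'))
    in subst (λ v → tubes T v ≡ true) (sym t≡push)
         (cancel-pushed {T} {T'} le i (pullG i t) (subst (λ v → tubes T' v ≡ true) t≡push t∈T'))

  fwd-injective : ∀ {T T'} → _≈P_ {k} {H} (fwd T) (fwd T') → _≈T_ {G} T T'
  fwd-injective {T} {T'} fT≈fT' t =
    bool-ext (fwd-cancel {T'} {T} (≈P⇒≥P {a = fwd T} {b = fwd T'} fT≈fT') t)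
             (fwd-cancel {T} {T'} (≈P⇒≤P {a = fwd T} {b = fwd T'} fT≈fT') t)

  fwd-surjective : ∀ y → ∃[ T ] (∀ {T'} → _≈T_ {G} T' T → _≈P_ {k} {H} (fwd T') y)
  fwd-surjective y = glue , λ {T'} T'≈glue →
    ≈P-trans {a = fwd T'} {b = fwd glue} {c = y} (fwd-cong {T'} {glue} T'≈glue) fwd-glue
    where open Glue y using (glue; fwd-glue)

theorem2 : (G : Pseudograph) (k : ℕ) (H : Fin k → Pseudograph) →
    2 ≤ k → HasComponents G k H → FacePosetIso G k H
theorem2 G k H two hc = fwd , record
  { isOrderMonomorphism = record
    { isOrderHomomorphism = record
      { cong = λ {T} {T'} → fwd-cong {T} {T'}
      ; mono = λ {T} {T'} → fwd-mono {T} {T'}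
      }
    ; injective = λ {T} {T'} → fwd-injective {T} {T'}
    ; cancel    = λ {T} {T'} → fwd-cancel {T} {T'}
    }
  ; surjective = fwd-surjective
  }
  where open FaceIso G k H two hc
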